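{- There exist graphs $G,G'$ such that $G'$ is obtained from $G$ by adding one edge and $\lambda(G,K_2)<\lambda(G',K_2)$.
   Context: All graphs are finite and simple. For a graph $G$, $d_v$ denotes the degree of $v$, $u\sim v$ means adjacency, and $\mathrm{vol}(G)=\sum_v d_v$. For a metric space $(X,d)$ and $f:V(G)\to X$ set $R_f(G,X)=\frac{\mathrm{vol}(G)\sum_{u\sim v} d(f(u),f(v))^2}{\sum_{u,v} d(f(u),f(v))^2 d_u d_v}$, where the numerator sum is over edges of $G$ and the denominator sum over unordered pairs of vertices; $\lambda(G,X)=\inf_f R_f(G,X)$ over all $f$ with nonzero denominator. $K_2$ is regarded as a two-point metric space with distance $1$. -}

module Defs where

open import Data.Bool using (Bool; true; false; if_then_else_; _∨_; _∧_; _xor_)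
open import Data.Nat using (ℕ; zero; suc; _+_; _*_; NonZero)
open import Data.Fin using (Fin; zero; suc; _<?_; _≟_)
open import Data.Integer using (+_)
open import Data.Rational using (ℚ; _/_; _≤_; _<_)
open import Data.Product using (_×_)
open import Relation.Nullary.Decidable using (⌊_⌋)
open import Relation.Binary.PropositionalEquality using (_≡_)

record Graph (n : ℕ) : Set where
  field
    adj    : Fin n → Fin n → Bool
    sym    : ∀ u v → adj u v ≡ adj v u
    irrefl : ∀ u → adj u u ≡ false
open Graph public

sumFin : (n : ℕ) → (Fin n → ℕ) → ℕ
sumFin zero    g = 0
sumFin (suc n) g = g zero + sumFin n (λ i → g (suc i))

-- Σ over unordered pairs {u,v}, u ≠ v (encoded as u < v)
sumPairs : (n : ℕ) → (Fin n → Fin n → ℕ) → ℕ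
sumPairs n g = sumFin n (λ u → sumFin n (λ v → if ⌊ u <? v ⌋ then g u v else 0))

b2n : Bool → ℕ
b2n true  = 1
b2n false = 0

deg : ∀ {n} → Graph n → Fin n → ℕ
deg {n} G u = sumFin n (λ v → b2n (adj G u v))

vol : ∀ {n} → Graph n → ℕ
vol {n} G = sumFin n (deg G)

-- K₂ as the two-point metric space Bool with distance 1 between distinct points;
-- squared distance d(x,y)^2.
distK2² : Bool → Bool → ℕ
distK2² x y = b2n (x xor y)

numer : ∀ {n} → Graph n → (Fin n → Bool) → ℕ
numer {n} G f = vol G * sumPairs n (λ u v → b2n (adj G u v) * distK2² (f u) (f v))

denom : ∀ {n} → Graph n → (Fin n → Bool) → ℕ
denom {n} G f = sumPairs n (λ u v → distK2² (f u) (f v) * deg G u * deg G v)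

R : ∀ {n} (G : Graph n) (f : Fin n → Bool) → .{{NonZero (denom G f)}} → ℚ
R G f = (+ numer G f) / denom G f

IsLambdaK2 : ∀ {n} → Graph n → ℚ → Set
IsLambdaK2 {n} G q =
  (∀ (f : Fin n → Bool) → .(nz : NonZero (denom G f)) → q ≤ R G f {{nz}})
  × (∀ (r : ℚ) → (∀ (f : Fin n → Bool) → .(nz : NonZero (denom G f)) → r ≤ R G f {{nz}}) → r ≤ q)

AddsEdge : ∀ {n} → Graph n → Graph n → Fin n → Fin n → Set
AddsEdge G G' a b =
  (adj G a b ≡ false) × ((∀ x y → adj G' x y ≡
     (adj G x y ∨ ((⌊ x ≟ a ⌋ ∧ ⌊ y ≟ b ⌋) ∨ (⌊ x ≟ b ⌋ ∧ ⌊ y ≟ a ⌋)))))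

-- The perfect matching 0–1, 2–3 is disconnected, so the cut separating its two edges
-- has no crossing edge and λ = 0. Adding the edge 1–2 yields the path 0–1–2–3, which is
-- connected; over its 14 nontrivial cuts the quotient is minimised by the middle cut,
-- giving λ = vol · 1 / (d₀d₂ + d₀d₃ + d₁d₂ + d₁d₃) = 6 / 9 = 2/3 > 0.
module Submission where

open import Defs
open import Data.Bool using (Bool; true; false; _∨_; _∧_)
open import Data.Bool.Properties using (∧-comm; ∨-comm)
open import Data.Empty using (⊥-elim; ⊥-elim-irr)
open import Data.Integer using (+_)
open import Data.Fin using (Fin; zero; suc; _≟_)
open import Data.Nat using (ℕ; zero; suc; NonZero)
open import Data.Nat.Properties using (nonZero?)
open import Data.Product using (Σ; _×_; _,_)
open import Data.Rational using (ℚ; 0ℚ; _/_; _≤_; _<_; _≤?_; _<?_)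
open import Data.Rational.Properties using (nonNegative⁻¹; normalize-nonNeg)
open import Data.Vec using (Vec; []; _∷_; lookup; tabulate)
open import Relation.Nullary using (¬_; Dec; yes; no)
open import Relation.Nullary.Decidable using (⌊_⌋; map′; from-yes; _×-dec_)
open import Relation.Binary.PropositionalEquality using (_≡_; _≢_; refl; cong₂; trans; subst; ≢-sym)

∀-Bool? : ∀ {ℓ} {P : Bool → Set ℓ} → (∀ b → Dec (P b)) → Dec (∀ b → P b)
∀-Bool? P? = map′ (λ (t , f) → λ { true → t ; false → f }) (λ h → h true , h false)
                  (P? true ×-dec P? false)

∀-Vec? : ∀ {ℓ} n {P : Vec Bool n → Set ℓ} → (∀ v → Dec (P v)) → Dec (∀ v → P v)
∀-Vec? zero    P? = map′ (λ { p [] → p }) (λ h → h []) (P? [])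
∀-Vec? (suc n) P? = map′ (λ h → λ { (b ∷ v) → h b v }) (λ h b v → h (b ∷ v))
                         (∀-Bool? λ b → ∀-Vec? n λ v → P? (b ∷ v))

module _ {n : ℕ} where

  emptyGraph : Graph n
  emptyGraph = record { adj = λ _ _ → false ; sym = λ _ _ → refl ; irrefl = λ _ → refl }

  ≟-not-both : {a b : Fin n} → a ≢ b → ∀ u → ⌊ u ≟ a ⌋ ∧ ⌊ u ≟ b ⌋ ≡ false
  ≟-not-both {a} {b} a≢b u with u ≟ a | u ≟ b
  ... | no _     | _       = refl
  ... | yes _    | no _    = refl
  ... | yes refl | yes refl = ⊥-elim (a≢b refl)

  addEdge : (G : Graph n) (a b : Fin n) → a ≢ b → Graph n
  addEdge G a b a≢b = record { adj = adj′ ; sym = sym′ ; irrefl = irrefl′ }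
    where
    adj′ : Fin n → Fin n → Bool
    adj′ x y = adj G x y ∨ ((⌊ x ≟ a ⌋ ∧ ⌊ y ≟ b ⌋) ∨ (⌊ x ≟ b ⌋ ∧ ⌊ y ≟ a ⌋))

    sym′ : ∀ x y → adj′ x y ≡ adj′ y x
    sym′ x y = cong₂ _∨_ (sym G x y)
      (trans (∨-comm (⌊ x ≟ a ⌋ ∧ ⌊ y ≟ b ⌋) _)
              (cong₂ _∨_ (∧-comm ⌊ x ≟ b ⌋ ⌊ y ≟ a ⌋) (∧-comm ⌊ x ≟ a ⌋ ⌊ y ≟ b ⌋)))

    irrefl′ : ∀ u → adj′ u u ≡ false
    irrefl′ u rewrite irrefl G u | ≟-not-both a≢b u
                    | ≟-not-both (≢-sym a≢b) u = refl

  addEdge-addsEdge : (G : Graph n) {a b : Fin n} (a≢b : a ≢ b) →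
                     adj G a b ≡ false → AddsEdge G (addEdge G a b a≢b) a b
  addEdge-addsEdge G _ ab∉G = ab∉G , λ _ _ → refl

  R-nonNeg : (G : Graph n) (f : Fin n → Bool) .{{_ : NonZero (denom G f)}} → 0ℚ ≤ R G f
  R-nonNeg G f = nonNegative⁻¹ (R G f) {{normalize-nonNeg (numer G f) (denom G f)}}

  isLambdaK2-attained : (G : Graph n) (q : ℚ) →
                        (∀ f → .(nz : NonZero (denom G f)) → q ≤ R G f {{nz}}) →
                        (f₀ : Fin n → Bool) .{{_ : NonZero (denom G f₀)}} → R G f₀ ≡ q →
                        IsLambdaK2 G q
  isLambdaK2-attained G q lower f₀ {{nz}} R≡q = lower , λ r r-lower → subst (r ≤_) R≡q (r-lower f₀ nz)

  R-lowerBound? : (G : Graph n) (q : ℚ) (f : Fin n → Bool) →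
                  Dec (.(nz : NonZero (denom G f)) → q ≤ R G f {{nz}})
  R-lowerBound? G q f with nonZero? (denom G f)
  ... | no  denom≡0 = yes λ nz → ⊥-elim-irr (denom≡0 nz)
  ... | yes nz      = map′ (λ q≤R _ → q≤R) (λ q≤R → q≤R nz) (q ≤? R G f {{nz}})

v₀ v₁ v₂ v₃ : Fin 4
v₀ = zero
v₁ = suc zero
v₂ = suc (suc zero)
v₃ = suc (suc (suc zero))

matching₄ : Graph 4
matching₄ = addEdge (addEdge emptyGraph v₀ v₁ λ ()) v₂ v₃ λ ()

path₄ : Graph 4
path₄ = addEdge matching₄ v₁ v₂ λ ()

cut₀₁∣₂₃ : Fin 4 → Bool
cut₀₁∣₂₃ = lookup (true ∷ true ∷ false ∷ false ∷ [])

λ-matching₄ : IsLambdaK2 matching₄ 0ℚ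
λ-matching₄ = isLambdaK2-attained matching₄ 0ℚ (λ f nz → R-nonNeg matching₄ f {{nz}}) cut₀₁∣₂₃ refl

λ-path₄ : IsLambdaK2 path₄ (+ 2 / 3)
λ-path₄ = isLambdaK2-attained path₄ (+ 2 / 3) lowerBound cut₀₁∣₂₃ refl
  where
  lowerBound : ∀ f → .(nz : NonZero (denom path₄ f)) → + 2 / 3 ≤ R path₄ f {{nz}}
  -- numer and denom evaluate f only at the four vertices, where lookup (tabulate f) agrees
  -- with f by computation, so the exhaustive check over Vec Bool 4 applies to every f.
  lowerBound f = from-yes (∀-Vec? 4 λ v → R-lowerBound? path₄ (+ 2 / 3) (lookup v)) (tabulate f)

theorem6p3 : Σ ℕ λ n → Σ (Graph n) λ G → Σ (Graph n) λ G' → Σ (Fin n) λ a → Σ (Fin n) λ b →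
               ¬ (a ≡ b) × AddsEdge G G' a b ×
               (Σ ℚ λ q → Σ ℚ λ q' → IsLambdaK2 G q × IsLambdaK2 G' q' × q < q')
theorem6p3 = 4 , matching₄ , path₄ , v₁ , v₂ , (λ ()) , addEdge-addsEdge matching₄ (λ ()) refl
           , 0ℚ , + 2 / 3 , λ-matching₄ , λ-path₄ , from-yes (0ℚ <? + 2 / 3)
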